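{- The semifilter of IP sets is not countably Ramsey: there are sets $A_n\subseteq\omega$ ($n\in\omega$), none of which is an IP set, with $\bigcup_n A_n=\omega\setminus\{0\}$, such that no IP set $B\subseteq\omega$ has $B\cap A_n$ finite for every $n$.
   Context: A set $A\subseteq\omega$ is an IP set if there is an infinite set $\{a_i:i\in\omega\}\subseteq A$ (with the $a_i$ distinct) such that for every nonempty finite $F\subseteq\omega$ there is $j$ with $\sum_{i\in F}a_i=a_j$. A semifilter $\mathcal S$ (a family of subsets of $\omega$, $\emptyset\ne\mathcal S\ne\mathcal P(\omega)$, closed upwards under $\subseteq^*$, where $A\subseteq^*B$ means $A\setminus B$ finite) is countably Ramsey if whenever $A\in\mathcal S$ and $A=\bigcup_{n\in\omega}A_n$, either some $A_n\in\mathcal S$, or there is $B\subseteq A$ with $B\in\mathcal S$ and $B\cap A_n$ finite for every $n$. -}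

module Defs where

open import Level using (0ℓ)
open import Data.Nat using (ℕ; _<_)
open import Data.List using (List; []; _∷_; map)
open import Data.Nat.ListAction using (sum)
open import Data.List.Relation.Unary.Unique.Propositional using (Unique)
open import Data.Product using (Σ; ∃; _×_)
open import Relation.Unary using (Pred; _∩_)
open import Relation.Binary.PropositionalEquality using (_≡_; _≢_)
open import Function.Definitions using (Injective)

NonEmptyFinSet : List ℕ → Set
NonEmptyFinSet F = (F ≢ []) × Unique F

IsIP : Pred ℕ 0ℓ → Set
IsIP A = Σ (ℕ → ℕ) λ a →
           Injective _≡_ _≡_ a
         × (∀ i → A (a i))
         × (∀ (F : List ℕ) → NonEmptyFinSet F → ∃ λ j → sum (map a F) ≡ a j)

Finite : Pred ℕ 0ℓ → Set
Finite X = ∃ λ N → ∀ m → X m → m < N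

-- Split ω ∖ {0} by the 2-adic valuation: A n is the set of numbers
-- 2ⁿ·(odd).  The three claims of the theorem are then:
--   * no A n is an IP set, since the sum of two elements of A n has
--     valuation strictly larger than n and so leaves A n;
--   * every positive number has a 2-adic valuation, and 0 has none;
--   * an IP set B meets some A n in an infinite set.  Take a nonzero
--     x ∈ B of valuation n, bound the finitely many sets B ∩ A m with
--     m ≤ n by a single M, and pick z ∈ B with z > M + x.  If the valuation
--     of z is ≤ n then z itself is too large; otherwise x + z ∈ B has
--     valuation exactly n and is too large.

module Submission where

open import Defs
open import Level using (0ℓ)
open import Data.Nat using (ℕ; zero; suc; _+_; _*_; _^_; _≤_; _<_; _∸_; _⊔_; z≤n; s≤s; ≢-nonZero; _≤?_; _<?_)
open import Data.Nat.Properties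
open import Data.Nat.Induction using (<-rec)
open import Data.Nat.Tactic.RingSolver using (solve-∀)
open import Data.Product using (Σ; ∃; _×_; _,_)
open import Data.Sum using (_⊎_; inj₁; inj₂)
open import Data.List using ([]; _∷_; map)
open import Data.Nat.ListAction using (sum)
open import Data.List.Relation.Unary.All using () renaming ([] to []ᴬ; _∷_ to _∷ᴬ_)
open import Data.List.Relation.Unary.AllPairs using () renaming ([] to []ᴾ; _∷_ to _∷ᴾ_)
open import Relation.Nullary using (¬_; yes; no; contradiction)
open import Relation.Unary using (Pred; _∩_)
open import Relation.Binary.PropositionalEquality using (_≡_; _≢_; refl; sym; trans; cong; cong₂; subst; module ≡-Reasoning)
open import Function.Definitions using (Injective)
open import Function.Bundles using (_⇔_; mk⇔)

HasValuation : ℕ → Pred ℕ 0ℓ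
HasValuation n m = ∃ λ k → m ≡ 2 ^ n * (1 + 2 * k)

parity : ∀ m → ∃ λ q → m ≡ 2 * q ⊎ m ≡ 1 + 2 * q
parity zero = 0 , inj₁ refl
parity (suc m) with parity m
... | q , inj₁ m≡2q   = q , inj₂ (cong suc m≡2q)
... | q , inj₂ m≡1+2q = suc q , inj₁ (trans (cong suc m≡1+2q) (sym (*-suc 2 q)))

valuation-exists : ∀ m → m ≢ 0 → ∃ λ n → HasValuation n m
valuation-exists = <-rec _ step
  where
    step : ∀ m → (∀ {q} → q < m → q ≢ 0 → ∃ λ n → HasValuation n q) →
           m ≢ 0 → ∃ λ n → HasValuation n m
    step m ih m≢0 with parity m
    ... | q , inj₂ m≡1+2q = 0 , q , trans m≡1+2q (sym (+-identityʳ _))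
    ... | q , inj₁ m≡2q with ih q<m q≢0
      where
        q≢0 : q ≢ 0
        q≢0 refl = m≢0 m≡2q
        q<m : q < m
        q<m = subst (q <_) (trans (*-comm q 2) (sym m≡2q)) (m<m*n q 2 {{≢-nonZero q≢0}} (s≤s (s≤s z≤n)))
    ... | n , k , q≡ = suc n , k , trans m≡2q (trans (cong (2 *_) q≡) (sym (*-assoc 2 (2 ^ n) _)))

valuation-nonzero : ∀ {n m} → HasValuation n m → m ≢ 0
valuation-nonzero {n} (k , m≡) refl with m*n≡0⇒m≡0∨n≡0 (2 ^ n) (sym m≡)
... | inj₁ 2ⁿ≡0 = contradiction (m^n≡0⇒m≡0 2 n 2ⁿ≡0) (λ ())
... | inj₂ ()

-- The sum of two numbers of valuation n has valuation > n, in particular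
-- not n: after cancelling 2ⁿ it is even, while an element of valuation n
-- is 2ⁿ · odd.
sum-leaves-valuation : ∀ {n x y} → HasValuation n x → HasValuation n y →
                       ¬ HasValuation n (x + y)
sum-leaves-valuation {n} {x} {y} (k , x≡) (l , y≡) (j , x+y≡) =
  even≢odd (1 + (k + l)) j (*-cancelˡ-≡ _ _ (2 ^ n) {{m^n≢0 2 n}} 2ⁿ·even≡2ⁿ·odd)
  where
    open ≡-Reasoning
    2ⁿ·even≡2ⁿ·odd : 2 ^ n * (2 * (1 + (k + l))) ≡ 2 ^ n * (1 + 2 * j)
    2ⁿ·even≡2ⁿ·odd = begin
      2 ^ n * (2 * (1 + (k + l)))                ≡⟨ identity (2 ^ n) k l ⟩
      2 ^ n * (1 + 2 * k) + 2 ^ n * (1 + 2 * l)  ≡⟨ sym (cong₂ _+_ x≡ y≡) ⟩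
      x + y                                      ≡⟨ x+y≡ ⟩
      2 ^ n * (1 + 2 * j)                        ∎
      where
        identity : ∀ p k l → p * (2 * (1 + (k + l))) ≡ p * (1 + 2 * k) + p * (1 + 2 * l)
        identity = solve-∀

-- Adding a number of strictly larger valuation does not change the
-- valuation: 2ⁿ·odd + 2ⁿ·even = 2ⁿ·odd.
sum-keeps-smaller-valuation : ∀ {n m x z} → HasValuation n x → HasValuation m z →
                              n < m → HasValuation n (x + z)
sum-keeps-smaller-valuation {n} {m} {x} {z} (k , x≡) (l , z≡) n<m =
  k + 2 ^ d * (1 + 2 * l) , (begin
    x + z                                            ≡⟨ cong₂ _+_ x≡ z≡ ⟩
    2 ^ n * (1 + 2 * k) + 2 ^ m * (1 + 2 * l)        ≡⟨ cong (λ e → 2 ^ n * (1 + 2 * k) + 2 ^ e * (1 + 2 * l)) (sym m≡) ⟩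
    2 ^ n * (1 + 2 * k) + 2 ^ (suc n + d) * (1 + 2 * l)
      ≡⟨ cong (λ t → 2 ^ n * (1 + 2 * k) + t * (1 + 2 * l)) (^-distribˡ-+-* 2 (suc n) d) ⟩
    2 ^ n * (1 + 2 * k) + 2 ^ suc n * 2 ^ d * (1 + 2 * l)  ≡⟨ identity (2 ^ n) k (2 ^ d) l ⟩
    2 ^ n * (1 + 2 * (k + 2 ^ d * (1 + 2 * l)))      ∎)
  where
    open ≡-Reasoning
    d : ℕ
    d = m ∸ suc n
    m≡ : suc n + d ≡ m
    m≡ = m+[n∸m]≡n n<m
    identity : ∀ p k q l → p * (1 + 2 * k) + 2 * p * q * (1 + 2 * l) ≡ p * (1 + 2 * (k + q * (1 + 2 * l)))
    identity = solve-∀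

-- Inductively, if
-- M ≤ f i and the bound is not strict then f i = M, and the tail of f
-- after i (again injective) has a term ≥ M which cannot equal M.
injective-unbounded : ∀ (f : ℕ → ℕ) → Injective _≡_ _≡_ f → ∀ M → ∃ λ i → M ≤ f i
injective-unbounded f f-inj zero = 0 , z≤n
injective-unbounded f f-inj (suc M) with injective-unbounded f f-inj M
... | i , M≤fi with M <? f i
...   | yes M<fi = i , M<fi
...   | no  M≮fi = beyond-M (injective-unbounded tail tail-inj M)
  where
    tail : ℕ → ℕ
    tail k = f (suc (i + k))
    tail-inj : Injective _≡_ _≡_ tail
    tail-inj eq = +-cancelˡ-≡ i _ _ (suc-injective (f-inj eq))
    fi≡M : f i ≡ M
    fi≡M = ≤-antisym (≮⇒≥ M≮fi) M≤fi
    beyond-M : (∃ λ k → M ≤ tail k) → ∃ λ j → suc M ≤ f j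
    beyond-M (k , M≤tailk) = suc (i + k) , ≤∧≢⇒< M≤tailk M≢tailk
      where
        M≢tailk : M ≢ tail k
        M≢tailk eq = m≢1+m+n i (sym (f-inj (trans (sym eq) (sym fi≡M))))

pair-sum : ∀ (a : ℕ → ℕ) → (∀ F → NonEmptyFinSet F → ∃ λ j → sum (map a F) ≡ a j) →
           ∀ {i j} → i ≢ j → ∃ λ k → a i + a j ≡ a k
pair-sum a sums {i} {j} i≢j with sums (i ∷ j ∷ []) ((λ ()) , ((i≢j ∷ᴬ []ᴬ) ∷ᴾ ([]ᴬ ∷ᴾ []ᴾ)))
... | k , sum≡ = k , trans (cong (a i +_) (sym (+-identityʳ (a j)))) sum≡

finite-union-bound : ∀ (X : ℕ → Pred ℕ 0ℓ) → (∀ n → Finite (X n)) →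
                     ∀ n₀ → ∃ λ M → ∀ {m y} → m ≤ n₀ → X m y → y < M
finite-union-bound X fin zero with fin 0
... | N , bound = N , λ { z≤n Xy → bound _ Xy }
finite-union-bound X fin (suc n₀) with finite-union-bound X fin n₀ | fin (suc n₀)
... | M , boundM | N , boundN = M ⊔ N , union-bound
  where
    union-bound : ∀ {m y} → m ≤ suc n₀ → X m y → y < M ⊔ N
    union-bound m≤ Xy with m≤n⇒m<n∨m≡n m≤
    ... | inj₁ m<suc = <-≤-trans (boundM (≤-pred m<suc) Xy) (m≤m⊔n M N)
    ... | inj₂ refl  = <-≤-trans (boundN _ Xy) (m≤n⊔m M N)

A : ℕ → Pred ℕ 0ℓ
A = HasValuation

levels-not-IP : ∀ n → ¬ IsIP (A n)
levels-not-IP n (a , _ , inA , sums) with pair-sum a sums {0} {1} (λ ())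
... | j , sum≡ = sum-leaves-valuation {n} (inA 0) (inA 1) (subst (A n) (sym sum≡) (inA j))

levels-cover : ∀ m → (∃ λ n → A n m) ⇔ (m ≢ 0)
levels-cover m = mk⇔ (λ (n , val) → valuation-nonzero {n} val) (valuation-exists m)

IP-meets-some-level : ∀ (B : Pred ℕ 0ℓ) → IsIP B → ¬ (∀ n → Finite (B ∩ A n))
IP-meets-some-level B (a , a-inj , inB , sums) finite
  with injective-unbounded a a-inj 1
... | i₀ , 1≤x with valuation-exists (a i₀) (λ x≡0 → contradiction (subst (1 ≤_) x≡0 1≤x) (λ ()))
... | n , x-val with finite-union-bound (λ m → B ∩ A m) finite n
... | M , bound with injective-unbounded a a-inj (suc (a i₀) + M)
... | i , x+M<z with valuation-exists (a i) (λ z≡0 → contradiction (subst (suc (a i₀) + M ≤_) z≡0 x+M<z) (λ ()))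
... | m , z-val with m ≤? n
...   | yes m≤n = <⇒≱ (bound m≤n (inB i , z-val)) M≤z
  where
    M≤z : M ≤ a i
    M≤z = ≤-trans (m≤n+m M _) x+M<z
...   | no  m≰n with pair-sum a sums i₀≢i
  where
    i₀≢i : i₀ ≢ i
    i₀≢i refl = <-irrefl refl (≤-trans (m≤m+n _ M) x+M<z)
...     | k , x+z≡ = <⇒≱ (bound ≤-refl (inB k , subst (A n) x+z≡ x+z-val)) M≤x+z
  where
    x+z-val : A n (a i₀ + a i)
    x+z-val = sum-keeps-smaller-valuation x-val z-val (≰⇒> m≰n)
    M≤x+z : M ≤ a k
    M≤x+z = subst (M ≤_) x+z≡ (≤-trans (≤-trans (m≤n+m M _) x+M<z) (m≤n+m _ (a i₀)))

proposition6p7 : Σ (ℕ → Pred ℕ 0ℓ) λ A →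
                   (∀ n → ¬ IsIP (A n))
                 × (∀ m → (∃ λ n → A n m) ⇔ (m ≢ 0))
                 × (∀ (B : Pred ℕ 0ℓ) → IsIP B → ¬ (∀ n → Finite (B ∩ A n)))
proposition6p7 = A , levels-not-IP , levels-cover , IP-meets-some-level
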